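{- The map $T_0:\triangle_0\to M_0$ and the map $T_1:\triangle_1\to M_1$ defined below are each bijections (one-to-one and onto).
   Context: A partition is written $(\lambda_1,\dots,\lambda_m)\times[k_1,\dots,k_m]$, where $m\ge1$, the parts $\lambda_i$ are integers with $\lambda_1>\dots>\lambda_m>0$ and the multiplicities $k_i$ are positive integers; $m$ is its dimension. Among partitions of dimension $m\ge2$: $\triangle_0$ is the set with $\lambda_1<\lambda_2+\lambda_m$, $\triangle_1$ the set with $\lambda_1>\lambda_2+\lambda_m$ (for $m=2$, $\lambda_2+\lambda_m$ means $2\lambda_2$). $M_0$ is the set of partitions with $k_1>k_m$, and $M_1$ the set with $k_1<k_m$ (these necessarily have dimension $\ge2$). $T_0(\lambda)=(\lambda_2,\dots,\lambda_m,\lambda_1-\lambda_2)\times[k_1+k_2,k_3,\dots,k_m,k_1]$ (for $m=2$: $(\lambda_2,\lambda_1-\lambda_2)\times[k_1+k_2,k_1]$), and $T_1(\lambda)=(\lambda_1-\lambda_m,\lambda_2,\dots,\lambda_m)\times[k_1,\dots,k_{m-1},k_1+k_m]$ (for $m=2$: $(\lambda_1-\lambda_2,\lambda_2)\times[k_1,k_1+k_2]$). -}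

module Defs where

open import Data.Nat using (ℕ; _+_; _∸_; _<_; _≤_)
open import Data.Product using (_×_; _,_; proj₁; proj₂; Σ; Σ-syntax)
open import Data.List using (List; []; _∷_; _++_; [_]; length)
open import Data.List.Relation.Unary.All using (All)
open import Data.List.Relation.Unary.Linked using (Linked)
open import Data.Empty using (⊥)
open import Relation.Binary.PropositionalEquality using (_≡_)

-- A partition (λ₁,…,λₘ)×[k₁,…,kₘ] is encoded as the list
-- (λ₁ , k₁) ∷ … ∷ (λₘ , kₘ) ∷ []  of (part , multiplicity) pairs.
Part : Set
Part = List (ℕ × ℕ)

part : ℕ × ℕ → ℕ
part = proj₁

mult : ℕ × ℕ → ℕ
mult = proj₂

record IsPartition (p : Part) : Set where
  field
    nonempty  : 1 ≤ length p
    decreasing : Linked (λ x y → part y < part x) p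
    positive  : All (λ x → 0 < part x × 0 < mult x) p

lastOf : ℕ × ℕ → List (ℕ × ℕ) → ℕ × ℕ
lastOf x [] = x
lastOf x (y ∷ r) = lastOf y r

initOf : ℕ × ℕ → List (ℕ × ℕ) → List (ℕ × ℕ)
initOf x [] = []
initOf x (y ∷ r) = x ∷ initOf y r

InTri0 : Part → Set
InTri0 (x ∷ y ∷ r) = part x < part y + part (lastOf y r)
InTri0 _ = ⊥

InTri1 : Part → Set
InTri1 (x ∷ y ∷ r) = part y + part (lastOf y r) < part x
InTri1 _ = ⊥

InM0 : Part → Set
InM0 (x ∷ r) = mult (lastOf x r) < mult x
InM0 [] = ⊥

InM1 : Part → Set
InM1 (x ∷ r) = mult x < mult (lastOf x r)
InM1 [] = ⊥

T0 : Part → Part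
T0 ((l1 , k1) ∷ (l2 , k2) ∷ r) = (l2 , k1 + k2) ∷ r ++ [ (l1 ∸ l2 , k1) ]
T0 p = p

T1 : Part → Part
T1 ((l1 , k1) ∷ y ∷ r) =
  (l1 ∸ part (lastOf y r) , k1) ∷ initOf y r ++ [ (part (lastOf y r) , k1 + mult (lastOf y r)) ]
T1 p = p

IsBijectionBetween : (Part → Set) → (Part → Set) → (Part → Part) → Set
IsBijectionBetween A B f =
  ((p : Part) → IsPartition p → A p → IsPartition (f p) × B (f p))
  × ((p q : Part) → IsPartition p → A p → IsPartition q → A q → f p ≡ f q → p ≡ q)
  × ((q : Part) → IsPartition q → B q → Σ[ p ∈ Part ] (IsPartition p × A p × f p ≡ q))

{-# OPTIONS --safe #-}
module Submission where

open import Defs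
open import Data.Nat using (ℕ; _+_; _∸_; _<_; s≤s; z≤n)
open import Data.Nat.Properties
open import Data.Product using (_×_; _,_; proj₁; proj₂; map₁)
open import Data.List using ([]; _∷_; _++_; [_])
open import Data.List.Relation.Unary.All using (All; []; _∷_)
open import Data.List.Relation.Unary.All.Properties using (++⁺)
open import Data.List.Relation.Unary.Linked using (Linked; [-]; _∷_)
open import Data.Empty using (⊥-elim)
open import Relation.Binary.PropositionalEquality
  using (_≡_; refl; sym; trans; cong; cong₂; subst; module ≡-Reasoning)

-- Writing a partition of dimension m ≥ 2 as first part, middle parts and
-- last part, both maps have explicit inverses:
--   T₀⁻¹ : (λ₁+λₘ, λ₁, λ₂, …, λₘ₋₁) × [kₘ, k₁−kₘ, k₂, …, kₘ₋₁],
--   T₁⁻¹ : (λ₁+λₘ, λ₂, …, λₘ) × [k₁, …, kₘ₋₁, kₘ−k₁].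
-- The subtractions in Tᵢ and Tᵢ⁻¹ are exact on the respective domains, the
-- inequality defining △ᵢ is what keeps the image strictly decreasing, and
-- the multiplicity added by Tᵢ to k₁ resp. kₘ is what puts the image in Mᵢ.

lastOf-∷ʳ : ∀ x s w → lastOf x (s ++ [ w ]) ≡ w
lastOf-∷ʳ x []      w = refl
lastOf-∷ʳ x (y ∷ s) w = lastOf-∷ʳ y s w

initOf-∷ʳ : ∀ x s w → initOf x (s ++ [ w ]) ≡ x ∷ s
initOf-∷ʳ x []      w = refl
initOf-∷ʳ x (y ∷ s) w = cong (x ∷_) (initOf-∷ʳ y s w)

initOf-++-lastOf : ∀ x r → initOf x r ++ [ lastOf x r ] ≡ x ∷ r
initOf-++-lastOf x []      = refl
initOf-++-lastOf x (y ∷ r) = cong (x ∷_) (initOf-++-lastOf y r)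

All-initOf-lastOf : ∀ {P : ℕ × ℕ → Set} x r → All P (x ∷ r) → All P (initOf x r) × P (lastOf x r)
All-initOf-lastOf x []      (px ∷ []) = [] , px
All-initOf-lastOf x (y ∷ r) (px ∷ ps) = map₁ (px ∷_) (All-initOf-lastOf y r ps)

module _ {R : ℕ × ℕ → ℕ × ℕ → Set} where

  Linked-∷ʳ⁺ : ∀ x s w → Linked R (x ∷ s) → R (lastOf x s) w → Linked R (x ∷ s ++ [ w ])
  Linked-∷ʳ⁺ x []      w _         Rxw = Rxw ∷ [-]
  Linked-∷ʳ⁺ x (y ∷ s) w (Rxy ∷ l) Rxw = Rxy ∷ Linked-∷ʳ⁺ y s w l Rxw

  Linked-∷ʳ⁻ : ∀ x s w → Linked R (x ∷ s ++ [ w ]) → Linked R (x ∷ s) × R (lastOf x s) w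
  Linked-∷ʳ⁻ x []      w (Rxw ∷ _) = [-] , Rxw
  Linked-∷ʳ⁻ x (y ∷ s) w (Rxy ∷ l) = map₁ (Rxy ∷_) (Linked-∷ʳ⁻ y s w l)

  Linked-initOf-lastOf : ∀ x y r → Linked R (x ∷ y ∷ r) →
                         Linked R (x ∷ initOf y r) × R (lastOf x (initOf y r)) (lastOf y r)
  Linked-initOf-lastOf x y r l =
    Linked-∷ʳ⁻ x (initOf y r) (lastOf y r) (subst (λ t → Linked R (x ∷ t)) (sym (initOf-++-lastOf y r)) l)

_≻_ : ℕ × ℕ → ℕ × ℕ → Set
x ≻ y = part y < part x

Descending : Part → Set
Descending = Linked _≻_

Positive : ℕ × ℕ → Set
Positive x = 0 < part x × 0 < mult x

isPartition : ∀ {x s} → Descending (x ∷ s) → All Positive (x ∷ s) → IsPartition (x ∷ s)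
isPartition d ps = record { nonempty = s≤s z≤n ; decreasing = d ; positive = ps }

Descending-withHeadMult : ∀ x k s → Descending (x ∷ s) → Descending ((part x , k) ∷ s)
Descending-withHeadMult x k []      _         = [-]
Descending-withHeadMult x k (y ∷ s) (x≻y ∷ d) = x≻y ∷ d

part-lastOf-withHeadMult : ∀ x k s → part (lastOf (part x , k) s) ≡ part (lastOf x s)
part-lastOf-withHeadMult x k []      = refl
part-lastOf-withHeadMult x k (y ∷ s) = refl

Descending-withLastMult : ∀ x y r k → Descending (x ∷ y ∷ r) →
                          Descending (x ∷ initOf y r ++ [ (part (lastOf y r) , k) ])
Descending-withLastMult x y r k d =
  let (d′ , x≻w) = Linked-initOf-lastOf x y r d in Linked-∷ʳ⁺ x (initOf y r) _ d′ x≻w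

InTri1-withLastMult : ∀ x y r k → part y + part (lastOf y r) < part x →
                      InTri1 (x ∷ initOf y r ++ [ (part (lastOf y r) , k) ])
InTri1-withLastMult x y []      k tri = tri
InTri1-withLastMult x y (z ∷ r) k tri =
  subst (λ v → part y + part v < part x) (sym (lastOf-∷ʳ y (initOf z r) _)) tri

T0⁻¹ : Part → Part
T0⁻¹ (x ∷ y ∷ r) = (part x + part w , mult w) ∷ (part x , mult x ∸ mult w) ∷ initOf y r
  where w = lastOf y r
T0⁻¹ p = p

T1⁻¹ : Part → Part
T1⁻¹ (x ∷ y ∷ r) = (part x + part w , mult x) ∷ initOf y r ++ [ (part w , mult w ∸ mult x) ]
  where w = lastOf y r
T1⁻¹ p = p

T0⁻¹-∷ʳ : ∀ x s w → T0⁻¹ (x ∷ s ++ [ w ]) ≡ (part x + part w , mult w) ∷ (part x , mult x ∸ mult w) ∷ s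
T0⁻¹-∷ʳ x []      w = refl
T0⁻¹-∷ʳ x (y ∷ s) w rewrite lastOf-∷ʳ y s w | initOf-∷ʳ y s w = refl

T1⁻¹-∷ʳ : ∀ x s w → T1⁻¹ (x ∷ s ++ [ w ]) ≡ (part x + part w , mult x) ∷ s ++ [ (part w , mult w ∸ mult x) ]
T1⁻¹-∷ʳ x []      w = refl
T1⁻¹-∷ʳ x (y ∷ s) w rewrite lastOf-∷ʳ y s w | initOf-∷ʳ y s w = refl

T1-∷ʳ : ∀ x s w → T1 (x ∷ s ++ [ w ]) ≡ (part x ∸ part w , mult x) ∷ s ++ [ (part w , mult x + mult w) ]
T1-∷ʳ x []      w = refl
T1-∷ʳ x (y ∷ s) w rewrite lastOf-∷ʳ y s w | initOf-∷ʳ y s w = refl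

MapsInto : (Part → Set) → (Part → Set) → (Part → Part) → Set
MapsInto A B f = ∀ p → IsPartition p → A p → IsPartition (f p) × B (f p)

LeftInverseOn : (Part → Set) → (Part → Part) → (Part → Part) → Set
LeftInverseOn A g f = ∀ p → IsPartition p → A p → g (f p) ≡ p

inverse⇒IsBijectionBetween : ∀ {A B} f g → MapsInto A B f → MapsInto B A g →
                             LeftInverseOn A g f → LeftInverseOn B f g → IsBijectionBetween A B f
inverse⇒IsBijectionBetween f g f∈ g∈ gf fg = f∈ , injective , surjective
  where
  injective = λ p q P a Q a′ fp≡fq → trans (sym (gf p P a)) (trans (cong g fp≡fq) (gf q Q a′))
  surjective = λ q Q b → g q , proj₁ (g∈ q Q b) , proj₂ (g∈ q Q b) , fg q Q b

T0-mapsInto : MapsInto InTri0 InM0 T0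
T0-mapsInto (a ∷ b ∷ r)
  record { decreasing = a≻b ∷ d ; positive = (_ , ka>0) ∷ (lb>0 , kb>0) ∷ ps } tri =
  isPartition descending positive , inM0
  where
  lm = part (lastOf b r)
  la∸lb<lm : part a ∸ part b < lm
  la∸lb<lm = subst (part a ∸ part b <_) (m+n∸m≡n (part b) lm) (∸-monoˡ-< tri (<⇒≤ a≻b))
  descending = Linked-∷ʳ⁺ _ r _ (Descending-withHeadMult b _ r d)
                 (subst (part a ∸ part b <_) (sym (part-lastOf-withHeadMult b _ r)) la∸lb<lm)
  positive = (lb>0 , ≤-trans kb>0 (m≤n+m _ _)) ∷ ++⁺ ps ((m<n⇒0<n∸m a≻b , ka>0) ∷ [])
  inM0 = subst (λ v → mult v < mult a + mult b) (sym (lastOf-∷ʳ _ r _)) (m<m+n _ kb>0)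

T0⁻¹-mapsInto : MapsInto InM0 InTri0 T0⁻¹
T0⁻¹-mapsInto (x ∷ y ∷ r)
  record { decreasing = d ; positive = (lx>0 , _) ∷ ps } kw<kx =
  isPartition descending positive , inTri0
  where
  s = initOf y r
  w = lastOf y r
  s>0 = proj₁ (All-initOf-lastOf y r ps)
  w>0 = proj₂ (All-initOf-lastOf y r ps)
  xs-descending = proj₁ (Linked-initOf-lastOf x y r d)
  x≻w = proj₂ (Linked-initOf-lastOf x y r d)
  descending = m<m+n (part x) (proj₁ w>0) ∷ Descending-withHeadMult x _ s xs-descending
  positive = (≤-trans lx>0 (m≤m+n _ _) , proj₂ w>0) ∷ (lx>0 , m<n⇒0<n∸m kw<kx) ∷ s>0
  inTri0 = +-monoʳ-< (part x) (subst (part w <_) (sym (part-lastOf-withHeadMult x _ s)) x≻w)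
T0⁻¹-mapsInto (x ∷ []) _ kx<kx = ⊥-elim (<-irrefl refl kx<kx)

T1-mapsInto : MapsInto InTri1 InM1 T1
T1-mapsInto (a ∷ y ∷ r) record { decreasing = _ ∷ d ; positive = (_ , ka>0) ∷ ps } tri =
  isPartition descending positive , inM1
  where
  lw = part (lastOf y r)
  s>0 = proj₁ (All-initOf-lastOf y r ps)
  w>0 = proj₂ (All-initOf-lastOf y r ps)
  lw<la = ≤-<-trans (m≤n+m lw (part y)) tri
  ly<la∸lw : part y < part a ∸ lw
  ly<la∸lw = subst (_< part a ∸ lw) (m+n∸n≡m (part y) lw) (∸-monoˡ-< tri (m≤n+m lw (part y)))
  descending = Descending-withLastMult _ y r _ (ly<la∸lw ∷ d)
  positive = (m<n⇒0<n∸m lw<la , ka>0)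
           ∷ ++⁺ s>0 ((proj₁ w>0 , ≤-trans (proj₂ w>0) (m≤n+m _ _)) ∷ [])
  inM1 = subst (λ v → mult a < mult v) (sym (lastOf-∷ʳ _ (initOf y r) _)) (m<m+n _ (proj₂ w>0))

T1⁻¹-mapsInto : MapsInto InM1 InTri1 T1⁻¹
T1⁻¹-mapsInto (x ∷ y ∷ r) record { decreasing = x≻y ∷ d ; positive = (lx>0 , kx>0) ∷ ps } kx<kw =
  isPartition descending positive , inTri1
  where
  lw = part (lastOf y r)
  s>0 = proj₁ (All-initOf-lastOf y r ps)
  w>0 = proj₂ (All-initOf-lastOf y r ps)
  descending = Descending-withLastMult _ y r _ (<-≤-trans x≻y (m≤m+n _ lw) ∷ d)
  positive = (≤-trans lx>0 (m≤m+n _ _) , kx>0)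
           ∷ ++⁺ s>0 ((proj₁ w>0 , m<n⇒0<n∸m kx<kw) ∷ [])
  inTri1 = InTri1-withLastMult _ y r _ (+-monoˡ-< lw x≻y)
T1⁻¹-mapsInto (x ∷ []) _ kx<kx = ⊥-elim (<-irrefl refl kx<kx)

open ≡-Reasoning

T0⁻¹∘T0≡id : LeftInverseOn InTri0 T0⁻¹ T0
T0⁻¹∘T0≡id (a ∷ b ∷ r) record { decreasing = a≻b ∷ _ } _ = begin
  T0⁻¹ (T0 (a ∷ b ∷ r))
    ≡⟨ T0⁻¹-∷ʳ (part b , mult a + mult b) r (part a ∸ part b , mult a) ⟩
  (part b + (part a ∸ part b) , mult a) ∷ (part b , mult a + mult b ∸ mult a) ∷ r
    ≡⟨ cong₂ (λ l k → (l , mult a) ∷ (part b , k) ∷ r) (m+[n∸m]≡n (<⇒≤ a≻b)) (m+n∸m≡n (mult a) (mult b)) ⟩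
  a ∷ b ∷ r ∎

T0∘T0⁻¹≡id : LeftInverseOn InM0 T0 T0⁻¹
T0∘T0⁻¹≡id (x ∷ y ∷ r) _ kw<kx = begin
  T0 (T0⁻¹ (x ∷ y ∷ r))
    ≡⟨ cong₂ (λ k l → (part x , k) ∷ initOf y r ++ [ (l , mult w) ]) (m+[n∸m]≡n (<⇒≤ kw<kx)) (m+n∸m≡n (part x) (part w)) ⟩
  x ∷ initOf y r ++ [ w ]
    ≡⟨ cong (x ∷_) (initOf-++-lastOf y r) ⟩
  x ∷ y ∷ r ∎
  where w = lastOf y r
T0∘T0⁻¹≡id (x ∷ []) _ kx<kx = ⊥-elim (<-irrefl refl kx<kx)

T1⁻¹∘T1≡id : LeftInverseOn InTri1 T1⁻¹ T1
T1⁻¹∘T1≡id (a ∷ y ∷ r) _ tri = begin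
  T1⁻¹ (T1 (a ∷ y ∷ r))
    ≡⟨ T1⁻¹-∷ʳ (part a ∸ part w , mult a) (initOf y r) (part w , mult a + mult w) ⟩
  (part a ∸ part w + part w , mult a) ∷ initOf y r ++ [ (part w , mult a + mult w ∸ mult a) ]
    ≡⟨ cong₂ (λ l k → (l , mult a) ∷ initOf y r ++ [ (part w , k) ])
             (m∸n+n≡m (≤-trans (m≤n+m (part w) (part y)) (<⇒≤ tri))) (m+n∸m≡n (mult a) (mult w)) ⟩
  a ∷ initOf y r ++ [ w ]
    ≡⟨ cong (a ∷_) (initOf-++-lastOf y r) ⟩
  a ∷ y ∷ r ∎
  where w = lastOf y r

T1∘T1⁻¹≡id : LeftInverseOn InM1 T1 T1⁻¹
T1∘T1⁻¹≡id (x ∷ y ∷ r) _ kx<kw = begin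
  T1 (T1⁻¹ (x ∷ y ∷ r))
    ≡⟨ T1-∷ʳ (part x + part w , mult x) (initOf y r) (part w , mult w ∸ mult x) ⟩
  (part x + part w ∸ part w , mult x) ∷ initOf y r ++ [ (part w , mult x + (mult w ∸ mult x)) ]
    ≡⟨ cong₂ (λ l k → (l , mult x) ∷ initOf y r ++ [ (part w , k) ]) (m+n∸n≡m (part x) (part w)) (m+[n∸m]≡n (<⇒≤ kx<kw)) ⟩
  x ∷ initOf y r ++ [ w ]
    ≡⟨ cong (x ∷_) (initOf-++-lastOf y r) ⟩
  x ∷ y ∷ r ∎
  where w = lastOf y r
T1∘T1⁻¹≡id (x ∷ []) _ kx<kx = ⊥-elim (<-irrefl refl kx<kx)

mainTheorem3 : IsBijectionBetween InTri0 InM0 T0 × IsBijectionBetween InTri1 InM1 T1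
mainTheorem3 =
  inverse⇒IsBijectionBetween T0 T0⁻¹ T0-mapsInto T0⁻¹-mapsInto T0⁻¹∘T0≡id T0∘T0⁻¹≡id ,
  inverse⇒IsBijectionBetween T1 T1⁻¹ T1-mapsInto T1⁻¹-mapsInto T1⁻¹∘T1≡id T1∘T1⁻¹≡id
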